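{- Let $\mathcal{G}=(H,\sigma,\alpha,h_0)$ be a rooted combinatorial map and let $T$ be a spanning tree of its underlying graph. The fundamental cycle of an external edge $e$ (resp. the fundamental cocycle of an internal edge $e$) is $\mathcal{O}_T$-directed if and only if $e$ is $(\mathcal{G},T)$-active.
   Context: A rooted combinatorial map is $\mathcal{G}=(H,\sigma,\alpha,h_0)$ with $H$ a finite set of half-edges, $\sigma$ a permutation, $\alpha$ a fixed-point-free involution, $\langle\sigma,\alpha\rangle$ transitive on $H$, root $h_0$; its underlying graph has the cycles of $\sigma$ as vertices and the pairs $\{h,\alpha(h)\}$ as edges, a half-edge being incident to the vertex containing it (loops, multiple edges allowed). For a spanning tree $T$: edges in $T$ are internal, others external; the motion function $t(h)=\sigma\alpha(h)$ if the edge of $h$ is internal, $\sigma(h)$ otherwise, is a cyclic permutation of $H$; the $(\mathcal{G},T)$-order on $H$ is $h_0<t(h_0)<\dots<t^{|H|-1}(h_0)$, edges compared via their smaller half-edge. The fundamental cycle of an external edge $e$ is the set of $e'$ with $T-e'+e$ a spanning tree; the fundamental cocycle of an internal edge $e$ is the set of $e'$ with $T-e+e'$ a spanning tree (it is a cocycle, i.e. a minimal disconnecting edge set); an edge is $(\mathcal{G},T)$-active if minimal in its fundamental cycle (external) or cocycle (internal). An orientation assigns to each edge $\{h,h'\}$ an ordered pair $(h,h')$ (tail $h$, head $h'$; the arc goes from the vertex of $h$ to the vertex of $h'$). The orientation $\mathcal{O}_T$: for $e=\{h_1,h_2\}$ with $h_1<h_2$, $\mathcal{O}_T(e)=(h_1,h_2)$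 if $e$ is internal and $(h_2,h_1)$ if external. A cycle is directed if its arcs form a directed closed path; a cocycle is directed if, after its deletion leaves two components, all its arcs point toward the same component. -}

module Defs where

open import Data.Nat using (ℕ; zero; suc; _<_)
open import Data.Fin using (Fin; zero; suc)
open import Data.Bool using (Bool; true; false; if_then_else_)
open import Data.Product using (Σ; ∃; ∃-syntax; _×_; _,_)
open import Data.Sum using (_⊎_)
open import Relation.Nullary using (¬_)
open import Relation.Binary.PropositionalEquality using (_≡_)
open import Relation.Binary.Construct.Closure.ReflexiveTransitive using (Star)
open import Function.Definitions using (Injective)

iter : ∀ {A : Set} → (A → A) → ℕ → A → A
iter f zero    x = x
iter f (suc k) x = f (iter f k x)

-- cyclic successor on Fin (suc k): i ↦ i+1 mod (k+1)
next : ∀ {k} → Fin (suc k) → Fin (suc k)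
next {zero}  _       = zero
next {suc k} zero    = suc zero
next {suc k} (suc i) with next {k} i
... | zero  = zero
... | suc j = suc (suc j)

record RootedMap : Set where
  field
    n        : ℕ
    σ        : Fin n → Fin n
    σ⁻¹      : Fin n → Fin n
    σσ⁻¹     : ∀ h → σ (σ⁻¹ h) ≡ h
    σ⁻¹σ     : ∀ h → σ⁻¹ (σ h) ≡ h
    α        : Fin n → Fin n
    α-invol  : ∀ h → α (α h) ≡ h
    α-fpf    : ∀ h → ¬ (α h ≡ h)
    -- ⟨σ,α⟩ is transitive on H: any two half-edges are related by the
    -- reflexive-transitive closure of single generator steps (σ, σ⁻¹, α = α⁻¹)
    transitive : ∀ h h' → Star (λ a b → (b ≡ σ a) ⊎ (b ≡ σ⁻¹ a) ⊎ (b ≡ α a)) h h'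
    root     : Fin n

module _ (G : RootedMap) where
  open RootedMap G

  -- Sets of edges are given as predicates on half-edges (closed under α where relevant).
  EdgeSet : Set₁
  EdgeSet = Fin n → Set

  -- h and h' lie in the same vertex (cycle of σ)
  SameVertex : Fin n → Fin n → Set
  SameVertex h h' = ∃[ k ] iter σ k h ≡ h'

  SameEdge : Fin n → Fin n → Set
  SameEdge h h' = (h' ≡ h) ⊎ (h' ≡ α h)

  -- connectivity of the vertices of h and h' in the spanning subgraph with edge set S
  Conn : EdgeSet → Fin n → Fin n → Set
  Conn S = Star (λ a b → (b ≡ σ a) ⊎ (a ≡ σ b) ⊎ (S a × b ≡ α a))

  -- S is a spanning tree: connected, and acyclic (no edge of S has its endpoints
  -- connected in S minus that edge; in particular no loops)
  IsSpanningTree : EdgeSet → Set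
  IsSpanningTree S =
    (∀ h h' → Conn S h h') ×
    (∀ h → S h → ¬ Conn (λ x → S x × ¬ SameEdge h x) h (α h))

  -- A spanning tree T given as a Boolean edge labelling (true = internal)
  record SpanningTree : Set₁ where
    field
      T        : Fin n → Bool
      T-edge   : ∀ h → T (α h) ≡ T h
      T-tree   : IsSpanningTree (λ h → T h ≡ true)

  module _ (ST : SpanningTree) where
    open SpanningTree ST

    Internal : Fin n → Set
    Internal h = T h ≡ true

    motion : Fin n → Fin n
    motion h = if T h then σ (α h) else σ h

    _≺_ : Fin n → Fin n → Set
    h ≺ h' = ∃[ i ] ∃[ j ] (i < j × j < n × iter motion i root ≡ h × iter motion j root ≡ h')

    -- order on edges, via their smaller half-edges:
    -- min(edge h) < min(edge h')  iff  some half of edge h precedes both halves of edge h'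
    _≺E_ : Fin n → Fin n → Set
    e ≺E e' = ∃[ a ] (SameEdge e a × ∀ b → SameEdge e' b → a ≺ b)

    FundCycle : Fin n → EdgeSet
    FundCycle e e' = IsSpanningTree (λ x → (Internal x ⊎ SameEdge e x) × ¬ SameEdge e' x)

    FundCocycle : Fin n → EdgeSet
    FundCocycle e e' = IsSpanningTree (λ x → (Internal x × ¬ SameEdge e x) ⊎ SameEdge e' x)

    MinimalIn : Fin n → EdgeSet → Set
    MinimalIn e S = ∀ e' → S e' → ¬ (e' ≺E e)

    Active : Fin n → Set
    Active e = (¬ Internal e × MinimalIn e (FundCycle e))
             ⊎ (Internal e × MinimalIn e (FundCocycle e))

    -- The orientation O_T: h is the tail half-edge of its edge
    -- (the head half-edge is α h); for {h1,h2} with h1 < h2 the tail is h1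
    -- if internal and h2 if external.
    IsTail : Fin n → Set
    IsTail h = (Internal h × h ≺ α h) ⊎ (¬ Internal h × α h ≺ h)

    -- an edge set C is O_T-directed as a cycle: its arcs (listed by their tail
    -- half-edges f 0, …, f k, each edge of C exactly once) form a directed closed path
    DirectedCycle : EdgeSet → Set
    DirectedCycle C =
      ∃[ k ] Σ (Fin (suc k) → Fin n) λ f →
        Injective _≡_ _≡_ f ×
        (∀ i → IsTail (f i) × C (f i)) ×
        (∀ e → C e → ∃[ i ] SameEdge e (f i)) ×
        (∀ i → SameVertex (α (f i)) (f (next i)))

    -- an edge set D is O_T-directed as a cocycle: all its arcs point towards
    -- the same component of the graph with D deleted
    DirectedCocycle : EdgeSet → Set
    DirectedCocycle D =
      ∃[ c ] ∀ h → D h → IsTail h →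
        Conn (λ x → ¬ D x) (α h) c × ¬ Conn (λ x → ¬ D x) h c

{-# OPTIONS --safe #-}
-- Positions along the tour of T (the orbit of the root under the motion function, which visits every
-- half-edge) realise the (G,T)-order. For a tree edge with lower half l, the half-edges after l and up
-- to α l form exactly one side of the cut of T − l; so the fundamental cocycle of l consists of the
-- edges crossing this interval, and the fundamental cycle of an external edge e consists of e and the
-- tree edges whose interval e crosses. An edge smaller than e in its cycle or cocycle gives an arc
-- crossing one of these cuts the wrong way. Conversely, if e is minimal, every arc of the cocycle of l
-- points towards α l, and the cycle of e = {e₁ < e₂} consists of e₂ and, in tour order, the tree edges
-- entered between e₁ and e₂ and left after e₂; between two consecutive ones the tour only makes
-- excursions into subtrees, so it comes back to the vertex it left.
module Submission where

open import Defs
open import Data.Nat as ℕ using (ℕ; zero; suc; _+_; _∸_; _<_; _≤_; z≤n; s≤s; _<ᵇ_; _≤ᵇ_)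
import Data.Nat.Properties as ℕₚ
open import Data.Fin as Fin using (Fin; zero; suc; toℕ; fromℕ<)
import Data.Fin.Properties as Finₚ
open import Data.Bool using (Bool; true; false; not; _∧_; _xor_; if_then_else_)
open import Data.Bool.Properties using (¬-not; not-injective; xor-annihilates-not; T-≡; T-∧)
import Data.Bool.Properties as Boolₚ
open import Data.Product using (∃; _×_; _,_; proj₁; proj₂)
open import Data.Sum using (_⊎_; inj₁; inj₂; [_,_]′)
open import Data.Empty using (⊥; ⊥-elim)
open import Relation.Nullary using (¬_; Dec; yes; no; contradiction)
open import Relation.Nullary.Decidable using (decidable-stable; _×-dec_)
open import Relation.Unary using (_⊆_)
open import Relation.Binary.PropositionalEquality
  using (_≡_; _≢_; refl; sym; trans; cong; cong₂; subst; subst₂; ≢-sym)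
open import Relation.Binary.Construct.Closure.ReflexiveTransitive using (ε; _◅_; _◅◅_)
open import Relation.Binary.Definitions using (tri<; tri≈; tri>)
open import Function.Base using (id)
open import Function.Definitions using (Injective)
open import Function.Bundles using (_⇔_; mk⇔; Equivalence)

iter-+ : ∀ {A : Set} (f : A → A) m n x → iter f (m + n) x ≡ iter f m (iter f n x)
iter-+ f zero    n x = refl
iter-+ f (suc m) n x = cong f (iter-+ f m n x)

iter-injective : ∀ {A : Set} {f : A → A} → Injective _≡_ _≡_ f →
                 ∀ m {x y} → iter f m x ≡ iter f m y → x ≡ y
iter-injective f-inj zero    eq = eq
iter-injective f-inj (suc m) eq = iter-injective f-inj m (f-inj eq)

xor-cancelˡ : ∀ x {y z} → x xor y ≡ x xor z → y ≡ z
xor-cancelˡ false eq = eq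
xor-cancelˡ true  eq = not-injective eq

module _ {P : ℕ → Set} (P? : ∀ m → Dec (P m)) where

  least-below : ∀ m → (∃ λ k → k < m × P k × (∀ j → j < k → ¬ P j)) ⊎ (∀ j → j < m → ¬ P j)
  least-below zero = inj₂ (λ _ ())
  least-below (suc m) with least-below m
  ... | inj₁ (k , k<m , pk , below) = inj₁ (k , ℕₚ.m<n⇒m<1+n k<m , pk , below)
  ... | inj₂ none with P? m
  ...   | yes pm = inj₁ (m , ℕₚ.n<1+n m , pm , none)
  ...   | no ¬pm = inj₂ λ j j<1+m →
            [ none j , (λ { refl → ¬pm }) ]′ (ℕₚ.m≤n⇒m<n∨m≡n (ℕₚ.≤-pred j<1+m))

  least-witness : ∀ {m} → P m → ∃ λ k → P k × (∀ j → j < k → ¬ P j)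
  least-witness {m} pm with least-below (suc m)
  ... | inj₁ (k , _ , pk , below) = k , pk , below
  ... | inj₂ none = contradiction pm (none m (ℕₚ.n<1+n m))

record Enumeration (Q : ℕ → Set) (a b : ℕ) : Set where
  field
    size       : ℕ
    point      : ℕ → ℕ
    point-zero : point 0 ≡ a
    point-last : point (suc size) ≡ b
    point-step : ∀ j → j ≤ size → point j < point (suc j)
    point-Q    : ∀ j → j < size → Q (point (suc j))
    point-gap  : ∀ j → j ≤ size → ∀ r → point j < r → r < point (suc j) → ¬ Q r

  point-mono : ∀ {i j} → i < j → j ≤ suc size → point i < point j
  point-mono {i} {suc j} i<1+j 1+j≤ with ℕₚ.m≤n⇒m<n∨m≡n (ℕₚ.≤-pred i<1+j)
  ... | inj₁ i<j  = ℕₚ.<-trans (point-mono i<j (ℕₚ.<⇒≤ 1+j≤)) (point-step j (ℕₚ.≤-pred 1+j≤))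
  ... | inj₂ refl = point-step j (ℕₚ.≤-pred 1+j≤)

  point-injective : ∀ {i j} → i ≤ suc size → j ≤ suc size → point i ≡ point j → i ≡ j
  point-injective {i} {j} i≤ j≤ eq with ℕₚ.<-cmp i j
  ... | tri< i<j _ _ = contradiction eq (ℕₚ.<⇒≢ (point-mono i<j j≤))
  ... | tri≈ _ i≡j _ = i≡j
  ... | tri> _ _ j<i = contradiction (sym eq) (ℕₚ.<⇒≢ (point-mono j<i i≤))

  point≤last : ∀ {j} → j ≤ suc size → point j ≤ b
  point≤last {j} j≤ with ℕₚ.m≤n⇒m<n∨m≡n j≤
  ... | inj₁ j<  = subst (point j ≤_) point-last (ℕₚ.<⇒≤ (point-mono j< ℕₚ.≤-refl))
  ... | inj₂ refl = ℕₚ.≤-reflexive point-last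

  first<point : ∀ {j} → 0 < j → j ≤ suc size → a < point j
  first<point 0<j j≤ = subst (_< _) point-zero (point-mono 0<j j≤)

  point-onto : ∀ {r} → a < r → r < b → Q r → ∃ λ j → j ≤ size × point (suc j) ≡ r
  point-onto {r} a<r r<b qr = locate (suc size) ℕₚ.≤-refl (subst (r ≤_) (sym point-last) (ℕₚ.<⇒≤ r<b))
    where
    locate : ∀ j → j ≤ suc size → r ≤ point j → ∃ λ i → i ≤ size × point (suc i) ≡ r
    locate zero    _  r≤ = contradiction (subst (r ≤_) point-zero r≤) (ℕₚ.<⇒≱ a<r)
    locate (suc i) i< r≤ with point i ℕ.<? r
    ... | no  ¬p<r = locate i (ℕₚ.<⇒≤ i<) (ℕₚ.≮⇒≥ ¬p<r)
    ... | yes p<r with ℕₚ.m≤n⇒m<n∨m≡n r≤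
    ...   | inj₂ r≡  = i , ℕₚ.≤-pred i< , sym r≡
    ...   | inj₁ r<  = contradiction qr (point-gap i (ℕₚ.≤-pred i<) r p<r r<)

module _ {Q : ℕ → Set} (Q? : ∀ r → Dec (Q r)) where

  private
    cons : ∀ {a b} → Q (suc a) → Enumeration Q (suc a) b → Enumeration Q a b
    cons {a} q E = record
      { size = suc size
      ; point = λ { zero → a ; (suc j) → point j }
      ; point-zero = refl
      ; point-last = point-last
      ; point-step = λ { zero _ → subst (a <_) (sym point-zero) ℕₚ.≤-refl
                       ; (suc j) j≤ → point-step j (ℕₚ.≤-pred j≤) }
      ; point-Q = λ { zero _ → subst Q (sym point-zero) q
                    ; (suc j) j< → point-Q j (ℕₚ.≤-pred j<) }
      ; point-gap = λ { zero _ r a<r r< → contradiction (subst (r <_) point-zero r<) (ℕₚ.≤⇒≯ a<r)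
                      ; (suc j) j≤ → point-gap j (ℕₚ.≤-pred j≤) }
      }
      where open Enumeration E

    widen : ∀ {a b} → ¬ Q (suc a) → Enumeration Q (suc a) b → Enumeration Q a b
    widen {a} ¬q E = record
      { size = size
      ; point = λ { zero → a ; (suc j) → point (suc j) }
      ; point-zero = refl
      ; point-last = point-last
      ; point-step = λ { zero _ → ℕₚ.<-trans (subst (a <_) (sym point-zero) ℕₚ.≤-refl) (point-step 0 z≤n)
                       ; (suc j) j≤ → point-step (suc j) j≤ }
      ; point-Q = point-Q
      ; point-gap = λ { zero _ → gap₀ ; (suc j) j≤ → point-gap (suc j) j≤ }
      }
      where
      open Enumeration E
      gap₀ : ∀ r → a < r → r < point 1 → ¬ Q r
      gap₀ r a<r r< with ℕₚ.m≤n⇒m<n∨m≡n a<r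
      ... | inj₂ refl = ¬q
      ... | inj₁ 1+a<r = point-gap 0 z≤n r (subst (_< r) (sym point-zero) 1+a<r) r<

    enumerate-from : ∀ d {a b} → suc (d + a) ≡ b → Enumeration Q a b
    enumerate-from zero {a} refl = record
      { size = 0
      ; point = λ { zero → a ; (suc _) → suc a }
      ; point-zero = refl
      ; point-last = refl
      ; point-step = λ { zero _ → ℕₚ.≤-refl }
      ; point-Q = λ _ ()
      ; point-gap = λ { zero _ r a<r r<1+a → contradiction (ℕₚ.≤-pred r<1+a) (ℕₚ.<⇒≱ a<r) }
      }
    enumerate-from (suc d) {a} eq with Q? (suc a)
    ... | yes q = cons q (enumerate-from d (trans (cong suc (ℕₚ.+-suc d a)) eq))
    ... | no ¬q = widen ¬q (enumerate-from d (trans (cong suc (ℕₚ.+-suc d a)) eq))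

  abstract
    enumerate : ∀ {a b} → a < b → Enumeration Q a b
    enumerate {a} {b} a<b = enumerate-from (b ∸ suc a)
      (trans (sym (ℕₚ.+-suc (b ∸ suc a) a)) (ℕₚ.m∸n+n≡m a<b))

next-cases : ∀ {k} (i : Fin (suc k)) → (toℕ i ≡ k × next i ≡ zero) ⊎ toℕ (next i) ≡ suc (toℕ i)
next-cases {zero}  zero    = inj₁ (refl , refl)
next-cases {suc k} zero    = inj₂ refl
next-cases {suc k} (suc i) with next {k} i | next-cases {k} i
... | zero  | inj₁ (i≡k , _) = inj₁ (cong suc i≡k , refl)
... | suc j | inj₂ eq       = inj₂ (cong suc eq)

toℕ-iter-next : ∀ {k} d (i : Fin (suc k)) → toℕ i + d ≤ k → toℕ (iter next d i) ≡ toℕ i + d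
toℕ-iter-next zero    i _  = sym (ℕₚ.+-identityʳ (toℕ i))
toℕ-iter-next {k} (suc d) i i+1+d≤k with subst (_≤ k) (ℕₚ.+-suc (toℕ i) d) i+1+d≤k
... | i+d<k with next-cases (iter next d i) | toℕ-iter-next d i (ℕₚ.<⇒≤ i+d<k)
...   | inj₁ (≡k , _) | ih = ⊥-elim (ℕₚ.<-irrefl ≡k (subst (_< k) (sym ih) i+d<k))
...   | inj₂ eq       | ih = trans eq (trans (cong suc ih) (sym (ℕₚ.+-suc (toℕ i) d)))

iter-next-wraps : ∀ {k} (i : Fin (suc k)) → iter next (suc (k ∸ toℕ i)) i ≡ zero
iter-next-wraps {k} i with next-cases (iter next (k ∸ toℕ i) i)
... | inj₁ (_ , wraps) = wraps
... | inj₂ eq = contradiction (subst (_≤ k) (trans eq (cong suc reaches-k)) (ℕₚ.≤-pred (Finₚ.toℕ<n _)))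
                              (ℕₚ.n≮n k)
  where
  i≤k = ℕₚ.≤-pred (Finₚ.toℕ<n i)
  reaches-k : toℕ (iter next (k ∸ toℕ i) i) ≡ k
  reaches-k = trans (toℕ-iter-next _ i (ℕₚ.≤-reflexive (ℕₚ.m+[n∸m]≡n i≤k))) (ℕₚ.m+[n∸m]≡n i≤k)

iter-next-zero : ∀ {k} (j : Fin (suc k)) → iter next (toℕ j) zero ≡ j
iter-next-zero j = Finₚ.toℕ-injective (toℕ-iter-next (toℕ j) zero (ℕₚ.≤-pred (Finₚ.toℕ<n j)))

next-closed : ∀ {k} (P : Fin (suc k) → Set) → (∀ i → P i → P (next i)) → ∀ {i j} → P i → P j
next-closed {k} P step {i} {j} pi =
  subst P (iter-next-zero j) (iterate (toℕ j) (subst P (iter-next-wraps i) (iterate (suc (k ∸ toℕ i)) pi)))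
  where
  iterate : ∀ d {i} → P i → P (iter next d i)
  iterate zero    pi = pi
  iterate (suc d) pi = step _ (iterate d pi)

module Orbit {n} {f : Fin n → Fin n} (f-injective : Injective _≡_ _≡_ f) (x : Fin n) where

  orbit : ℕ → Fin n
  orbit i = iter f i x

  IsPeriod : ℕ → Set
  IsPeriod p = 0 < p × orbit p ≡ x

  private
    isPeriod? : ∀ p → Dec (IsPeriod p)
    isPeriod? zero = no λ ()
    isPeriod? (suc p) with orbit (suc p) Finₚ.≟ x
    ... | yes eq = yes (s≤s z≤n , eq)
    ... | no neq = no λ p → neq (proj₂ p)

    orbit-∸ : ∀ {i j} → i ≤ j → orbit j ≡ orbit i → orbit (j ∸ i) ≡ x
    orbit-∸ {i} {j} i≤j eq = iter-injective f-injective i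
      (trans (sym (iter-+ f i (j ∸ i) x)) (trans (cong orbit (ℕₚ.m+[n∸m]≡n i≤j)) eq))

  abstract
    minimal-period : ∃ λ p → IsPeriod p × ∀ j → j < p → ¬ IsPeriod j
    minimal-period with Finₚ.pigeonhole (ℕₚ.n<1+n n) (λ (i : Fin (suc n)) → orbit (toℕ i))
    ... | i , j , i<j , eq =
      least-witness isPeriod? (ℕₚ.m<n⇒0<n∸m i<j , orbit-∸ (ℕₚ.<⇒≤ i<j) (sym eq))

  period : ℕ
  period = proj₁ minimal-period

  period-positive : 0 < period
  period-positive = proj₁ (proj₁ (proj₂ minimal-period))

  orbit-period : orbit period ≡ x
  orbit-period = proj₂ (proj₁ (proj₂ minimal-period))

  orbit-+period : ∀ i → orbit (i + period) ≡ orbit i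
  orbit-+period i = trans (iter-+ f i period x) (cong (iter f i) orbit-period)

  orbit-distinct : ∀ {i j} → i < j → j < i + period → orbit j ≢ orbit i
  orbit-distinct {i} {j} i<j j<i+p eq =
    proj₂ (proj₂ minimal-period) (j ∸ i) j∸i<p (ℕₚ.m<n⇒0<n∸m i<j , orbit-∸ (ℕₚ.<⇒≤ i<j) eq)
    where
    j∸i<p : j ∸ i < period
    j∸i<p = ℕₚ.+-cancelˡ-< i (j ∸ i) period
              (subst (_< i + period) (sym (ℕₚ.m+[n∸m]≡n (ℕₚ.<⇒≤ i<j))) j<i+p)

  orbit-injective : ∀ {i j} → i < period → j < period → orbit i ≡ orbit j → i ≡ j
  orbit-injective {i} {j} i<p j<p eq with ℕₚ.<-cmp i j
  ... | tri< i<j _ _ = contradiction (sym eq) (orbit-distinct i<j (ℕₚ.<-≤-trans j<p (ℕₚ.m≤n+m period i)))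
  ... | tri≈ _ i≡j _ = i≡j
  ... | tri> _ _ j<i = contradiction eq (orbit-distinct j<i (ℕₚ.<-≤-trans i<p (ℕₚ.m≤n+m period j)))

  InOrbit : Fin n → Set
  InOrbit y = ∃ λ (i : Fin period) → orbit (toℕ i) ≡ y

  InOrbit? : ∀ y → Dec (InOrbit y)
  InOrbit? y = Finₚ.any? (λ i → orbit (toℕ i) Finₚ.≟ y)

  inOrbit : ∀ i → InOrbit (orbit i)
  inOrbit zero = fromℕ< period-positive , cong orbit (Finₚ.toℕ-fromℕ< period-positive)
  inOrbit (suc j) with inOrbit j
  ... | i , eq with ℕₚ.m≤n⇒m<n∨m≡n (Finₚ.toℕ<n i)
  ...   | inj₁ 1+i<p = fromℕ< 1+i<p , trans (cong orbit (Finₚ.toℕ-fromℕ< 1+i<p)) (cong f eq)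
  ...   | inj₂ 1+i≡p = subst InOrbit (trans (sym orbit-period) (trans (cong orbit (sym 1+i≡p)) (cong f eq)))
                             (inOrbit zero)

  InOrbit-f : ∀ {y} → InOrbit y → InOrbit (f y)
  InOrbit-f (i , refl) = inOrbit (suc (toℕ i))

  InOrbit-f⁻ : ∀ {y} → InOrbit (f y) → InOrbit y
  InOrbit-f⁻ {y} (i , eq) = from (toℕ i) eq
    where
    from : ∀ k → orbit k ≡ f y → InOrbit y
    from zero    eq = subst InOrbit (f-injective (trans wrap eq)) (inOrbit (ℕ.pred period))
      where
      wrap : orbit (suc (ℕ.pred period)) ≡ x
      wrap = trans (cong orbit (ℕₚ.suc-pred period {{ℕ.>-nonZero period-positive}})) orbit-period
    from (suc k) eq = subst InOrbit (f-injective eq) (inOrbit k)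

  module Positions (every : ∀ y → InOrbit y) where

    period≡n : period ≡ n
    period≡n = ℕₚ.≤-antisym
      (Finₚ.injective⇒≤ {f = λ (i : Fin period) → orbit (toℕ i)}
        λ eq → Finₚ.toℕ-injective (orbit-injective (Finₚ.toℕ<n _) (Finₚ.toℕ<n _) eq))
      (Finₚ.injective⇒≤ {f = λ y → proj₁ (every y)}
        λ {y} {y'} eq → trans (sym (proj₂ (every y))) (trans (cong (λ i → orbit (toℕ i)) eq) (proj₂ (every y'))))

    position : Fin n → ℕ
    position y = toℕ (proj₁ (every y))

    position<n : ∀ y → position y < n
    position<n y = subst (position y <_) period≡n (Finₚ.toℕ<n (proj₁ (every y)))

    orbit-position : ∀ y → orbit (position y) ≡ y
    orbit-position y = proj₂ (every y)

    orbit-n : orbit n ≡ x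
    orbit-n = subst (λ m → orbit m ≡ x) period≡n orbit-period

    position-orbit : ∀ {i} → i < n → position (orbit i) ≡ i
    position-orbit {i} i<n = orbit-injective (Finₚ.toℕ<n (proj₁ (every (orbit i)))) (subst (i <_) (sym period≡n) i<n)
                                             (orbit-position (orbit i))

    position-injective : ∀ {y y'} → position y ≡ position y' → y ≡ y'
    position-injective {y} {y'} eq = trans (sym (orbit-position y)) (trans (cong orbit eq) (orbit-position y'))

-- Connectivity in a combinatorial map

module _ (G : RootedMap) where
  open RootedMap G

  Conn-σ : ∀ {S} a → Conn G S a (σ a)
  Conn-σ a = inj₁ refl ◅ ε

  Conn-σ⁻ : ∀ {S} a → Conn G S (σ a) a
  Conn-σ⁻ a = inj₂ (inj₁ refl) ◅ ε

  Conn-α : ∀ {S a} → S a → Conn G S a (α a)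
  Conn-α s = inj₂ (inj₂ (s , refl)) ◅ ε

  Conn-mono : ∀ {S S'} → S ⊆ S' → ∀ {a b} → Conn G S a b → Conn G S' a b
  Conn-mono S⊆S' ε                           = ε
  Conn-mono S⊆S' (inj₁ p ◅ r)                = inj₁ p ◅ Conn-mono S⊆S' r
  Conn-mono S⊆S' (inj₂ (inj₁ p) ◅ r)         = inj₂ (inj₁ p) ◅ Conn-mono S⊆S' r
  Conn-mono S⊆S' (inj₂ (inj₂ (s , p)) ◅ r)   = inj₂ (inj₂ (S⊆S' s , p)) ◅ Conn-mono S⊆S' r

  Conn-sym : ∀ {S} → (∀ {a} → S a → S (α a)) → ∀ {a b} → Conn G S a b → Conn G S b a
  Conn-sym S-α ε                                 = ε
  Conn-sym S-α (inj₁ refl ◅ r)                   = Conn-sym S-α r ◅◅ Conn-σ⁻ _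
  Conn-sym S-α (inj₂ (inj₁ refl) ◅ r)            = Conn-sym S-α r ◅◅ Conn-σ _
  Conn-sym {S} S-α (inj₂ (inj₂ (s , refl)) ◅ r)  =
    Conn-sym S-α r ◅◅ subst (Conn G S _) (α-invol _) (Conn-α (S-α s))

  Conn-invariant : ∀ {S} (P : Fin n → Bool) → (∀ a → P (σ a) ≡ P a) →
                   (∀ {a} → S a → P (α a) ≡ P a) → ∀ {a b} → Conn G S a b → P a ≡ P b
  Conn-invariant P P-σ P-α ε                              = refl
  Conn-invariant P P-σ P-α (inj₁ refl ◅ r)                = trans (sym (P-σ _)) (Conn-invariant P P-σ P-α r)
  Conn-invariant P P-σ P-α (inj₂ (inj₁ refl) ◅ r)         = trans (P-σ _) (Conn-invariant P P-σ P-α r)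
  Conn-invariant P P-σ P-α (inj₂ (inj₂ (s , refl)) ◅ r)   = trans (sym (P-α s)) (Conn-invariant P P-σ P-α r)

  SameVertex-σ : ∀ {s y} → SameVertex G s y → SameVertex G s (σ y)
  SameVertex-σ (k , eq) = suc k , cong σ eq

  SameEdge-refl : ∀ h → SameEdge G h h
  SameEdge-refl h = inj₁ refl

  SameEdge-α : ∀ h → SameEdge G h (α h)
  SameEdge-α h = inj₂ refl

  SameEdge-sym : ∀ {a b} → SameEdge G a b → SameEdge G b a
  SameEdge-sym (inj₁ refl)     = inj₁ refl
  SameEdge-sym {a} (inj₂ refl) = inj₂ (sym (α-invol a))

  SameEdge-trans : ∀ {a b c} → SameEdge G a b → SameEdge G b c → SameEdge G a c
  SameEdge-trans ab         (inj₁ refl) = ab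
  SameEdge-trans (inj₁ refl) (inj₂ refl) = inj₂ refl
  SameEdge-trans {a} (inj₂ refl) (inj₂ refl) = inj₁ (α-invol a)

  SameEdge-αʳ : ∀ {h x} → SameEdge G h x → SameEdge G h (α x)
  SameEdge-αʳ {x = x} s = SameEdge-trans s (SameEdge-α x)

  SameEdge-α⁻ʳ : ∀ {h x} → SameEdge G h (α x) → SameEdge G h x
  SameEdge-α⁻ʳ {x = x} s = SameEdge-trans s (SameEdge-sym (SameEdge-α x))

  SameEdge? : ∀ a b → Dec (SameEdge G a b)
  SameEdge? a b with b Finₚ.≟ a | b Finₚ.≟ α a
  ... | yes b≡a | _       = yes (inj₁ b≡a)
  ... | no _    | yes b≡αa = yes (inj₂ b≡αa)
  ... | no b≢a  | no b≢αa  = no λ { (inj₁ b≡a) → b≢a b≡a ; (inj₂ b≡αa) → b≢αa b≡αa }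

  Crosses : (Fin n → Bool) → Fin n → Set
  Crosses P h = P h ≢ P (α h)

  crosses-by : ∀ {P : Fin n → Bool} {h} → P h ≡ false → P (α h) ≡ true → Crosses P h
  crosses-by Ph Pαh eq with () ← trans (sym Ph) (trans eq Pαh)

  crosses-into : ∀ {P : Fin n → Bool} {h} → Crosses P h → P h ≡ false → P (α h) ≡ true
  crosses-into crosses Ph = trans (¬-not (≢-sym crosses)) (cong not Ph)

  SameEdge-uncrossed : ∀ {P : Fin n → Bool} {h h'} → SameEdge G h h' → P h ≡ P (α h) → P h' ≡ P (α h')
  SameEdge-uncrossed (inj₁ refl) eq = eq
  SameEdge-uncrossed {P} {h} (inj₂ refl) eq = trans (sym eq) (sym (cong P (α-invol h)))

  SameEdge-crosses : ∀ {P : Fin n → Bool} {h h'} → SameEdge G h h' → Crosses P h → Crosses P h'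
  SameEdge-crosses s crosses eq = crosses (SameEdge-uncrossed (SameEdge-sym s) eq)

  crossing-half : ∀ {P : Fin n → Bool} {x} → Crosses P x →
                  ∃ λ b → SameEdge G x b × P b ≡ true × P (α b) ≡ false
  crossing-half {P} {x} crosses with P x in Px | P (α x) in Pαx
  ... | true  | true  = contradiction refl crosses
  ... | false | false = contradiction refl crosses
  ... | true  | false = x , SameEdge-refl x , Px , Pαx
  ... | false | true  = α x , SameEdge-α x , Pαx , trans (cong P (α-invol x)) Px

  ¬Crosses : ∀ {P : Fin n → Bool} {a} → ¬ Crosses P a → P (α a) ≡ P a
  ¬Crosses {P} {a} ¬crosses = sym (decidable-stable (P a Boolₚ.≟ P (α a)) ¬crosses)

  xor-Crosses : ∀ {P Q : Fin n → Bool} {a} → Crosses P a → Crosses Q a →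
                P (α a) xor Q (α a) ≡ P a xor Q a
  xor-Crosses {P} {Q} {a} P-crosses Q-crosses =
    trans (cong₂ _xor_ (¬-not (≢-sym P-crosses)) (¬-not (≢-sym Q-crosses))) (xor-annihilates-not (P a) (Q a))

  Conn-SameVertex : ∀ {S x y} → SameVertex G x y → Conn G S x y
  Conn-SameVertex {x = x} (k , refl) = along k
    where
    along : ∀ k → Conn G _ x (iter σ k x)
    along zero    = ε
    along (suc k) = along k ◅◅ Conn-σ (iter σ k x)

  IsSpanningTree-resp : ∀ {S S'} → S ⊆ S' → S' ⊆ S → IsSpanningTree G S → IsSpanningTree G S'
  IsSpanningTree-resp S⊆S' S'⊆S (connected , acyclic) =
    (λ h h' → Conn-mono S⊆S' (connected h h')) ,
    (λ h s' c → acyclic h (S'⊆S s') (Conn-mono (λ (s , ns) → S'⊆S s , ns) c))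

-- The tour of a spanning tree

module _ (G : RootedMap) (ST : SpanningTree G) where
  open RootedMap G
  open SpanningTree ST

  T-α : ∀ {x b} → T x ≡ b → T (α x) ≡ b
  T-α {x} eq = trans (T-edge x) eq

  SameEdge-T : ∀ {a b} → SameEdge G a b → T b ≡ T a
  SameEdge-T (inj₁ refl)     = refl
  SameEdge-T {a} (inj₂ refl) = T-edge a

  T-true-false : ∀ {x} → T x ≡ true → ¬ T x ≡ false
  T-true-false Tx Tx' with () ← trans (sym Tx) Tx'

  internal-external-¬SameEdge : ∀ {a b} → T a ≡ true → T b ≡ false → ¬ SameEdge G a b
  internal-external-¬SameEdge Ta Tb s = T-true-false Ta (trans (sym (SameEdge-T s)) Tb)

  TreeWithout : Fin n → Fin n → Set
  TreeWithout l x = T x ≡ true × ¬ SameEdge G l x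

  TreeWithout-α : ∀ l {x} → TreeWithout l x → TreeWithout l (α x)
  TreeWithout-α l (Tx , ¬s) = T-α Tx , λ s → ¬s (SameEdge-α⁻ʳ G s)

  tree-acyclic : ∀ {l} → T l ≡ true → ¬ Conn G (TreeWithout l) l (α l)
  tree-acyclic {l} = proj₂ T-tree l

  motion-internal : ∀ {x} → T x ≡ true → motion G ST x ≡ σ (α x)
  motion-internal eq rewrite eq = refl

  motion-external : ∀ {x} → T x ≡ false → motion G ST x ≡ σ x
  motion-external eq rewrite eq = refl

  motion-α-internal : ∀ {x} → T x ≡ true → motion G ST (α x) ≡ σ x
  motion-α-internal {x} Tx = trans (motion-internal (T-α Tx)) (cong σ (α-invol x))

  motion-injective : Injective _≡_ _≡_ (motion G ST)
  motion-injective {x} {y} eq = trans (sym (unmotion-motion x)) (trans (cong unmotion eq) (unmotion-motion y))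
    where
    unmotion : Fin n → Fin n
    unmotion y = if T (σ⁻¹ y) then α (σ⁻¹ y) else σ⁻¹ y
    unmotion-motion : ∀ h → unmotion (motion G ST h) ≡ h
    unmotion-motion h with T h in Th
    ... | true  rewrite σ⁻¹σ (α h) | T-α Th = α-invol h
    ... | false rewrite σ⁻¹σ h | Th = refl

  Conn-motion : ∀ {S} x → (T x ≡ true → S x) → Conn G S x (motion G ST x)
  Conn-motion x internal⇒S with T x in Tx
  ... | true  = Conn-α G (internal⇒S refl) ◅◅ Conn-σ G (α x)
  ... | false = Conn-σ G x

  open Orbit motion-injective root

  Conn-orbit : ∀ {S a b} → a ≤ b → (∀ j → a ≤ j → j < b → T (orbit j) ≡ true → S (orbit j)) →
               Conn G S (orbit a) (orbit b)
  Conn-orbit {b = zero}  z≤n _ = ε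
  Conn-orbit {S} {a} {suc b} a≤1+b internal⇒S with ℕₚ.m≤n⇒m<n∨m≡n a≤1+b
  ... | inj₂ refl = ε
  ... | inj₁ a<1+b =
    Conn-orbit (ℕₚ.≤-pred a<1+b) (λ j a≤j j<b → internal⇒S j a≤j (ℕₚ.m<n⇒m<1+n j<b)) ◅◅
    Conn-motion (orbit b) (internal⇒S b (ℕₚ.≤-pred a<1+b) ℕₚ.≤-refl)

  -- Otherwise the tour from motion h = σ (α h) back to h would join α h to h avoiding the edge of h.
  InOrbit-α : ∀ {h} → T h ≡ true → InOrbit h → InOrbit (α h)
  InOrbit-α {h} Th (i , refl) with InOrbit? (α h)
  ... | yes αh∈ = αh∈
  ... | no αh∉ = ⊥-elim (tree-acyclic Th (Conn-sym G (TreeWithout-α h) tour))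
    where
    i' = toℕ i
    i+1≤i+p : suc i' ≤ i' + period
    i+1≤i+p = subst (_≤ i' + period) (ℕₚ.+-comm i' 1) (ℕₚ.+-monoʳ-≤ i' period-positive)
    avoids : ∀ j → suc i' ≤ j → j < i' + period → T (orbit j) ≡ true → TreeWithout h (orbit j)
    avoids j i<j j<i+p Tj = Tj , λ
      { (inj₁ j≡i)  → orbit-distinct i<j j<i+p j≡i
      ; (inj₂ j≡αh) → αh∉ (subst InOrbit j≡αh (inOrbit j)) }
    tour : Conn G (TreeWithout h) (α h) h
    tour = Conn-σ G (α h) ◅◅ subst₂ (Conn G (TreeWithout h)) (motion-internal Th) (orbit-+period i')
                                   (Conn-orbit i+1≤i+p avoids)

  InOrbit-σ : ∀ {a} → InOrbit a → InOrbit (σ a)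
  InOrbit-σ {a} a∈ with T a in Ta
  ... | true  = subst InOrbit (motion-α-internal Ta) (InOrbit-f (InOrbit-α Ta a∈))
  ... | false = subst InOrbit (motion-external Ta) (InOrbit-f a∈)

  InOrbit-σ⁻ : ∀ {a} → InOrbit (σ a) → InOrbit a
  InOrbit-σ⁻ {a} σa∈ with T a in Ta
  ... | true  = subst InOrbit (α-invol a)
                  (InOrbit-α (T-α Ta) (InOrbit-f⁻ (subst InOrbit (sym (motion-α-internal Ta)) σa∈)))
  ... | false = InOrbit-f⁻ (subst InOrbit (sym (motion-external Ta)) σa∈)

  abstract
    everyInOrbit : ∀ h → InOrbit h
    everyInOrbit h = spread (proj₁ T-tree root h) (inOrbit 0)
      where
      spread : ∀ {a b} → Conn G (λ x → T x ≡ true) a b → InOrbit a → InOrbit b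
      spread ε                            a∈ = a∈
      spread (inj₁ refl ◅ r)              a∈ = spread r (InOrbit-σ a∈)
      spread (inj₂ (inj₁ refl) ◅ r)       a∈ = spread r (InOrbit-σ⁻ a∈)
      spread (inj₂ (inj₂ (Ta , refl)) ◅ r) a∈ = spread r (InOrbit-α Ta a∈)

  open Positions everyInOrbit

  ≺⇒position< : ∀ {h h'} → _≺_ G ST h h' → position h < position h'
  ≺⇒position< (i , j , i<j , j<n , refl , refl) =
    subst₂ _<_ (sym (position-orbit (ℕₚ.<-trans i<j j<n))) (sym (position-orbit j<n)) i<j

  position<⇒≺ : ∀ {h h'} → position h < position h' → _≺_ G ST h h'
  position<⇒≺ {h} {h'} lt = position h , position h' , lt , position<n h' , orbit-position h , orbit-position h'

  position-motion : ∀ h → suc (position h) < n → position (motion G ST h) ≡ suc (position h)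
  position-motion h lt = trans (cong (λ y → position (motion G ST y)) (sym (orbit-position h))) (position-orbit lt)

  position-α≢ : ∀ h → position h ≢ position (α h)
  position-α≢ h eq = α-fpf h (sym (position-injective eq))

  ReturnsBefore : Fin n → Fin n → Fin n → Set
  ReturnsBefore s y t = ∀ y' → SameVertex G s y' → position y ≤ position y' → position y' < position t →
                        T y' ≡ true → position y' < position (α y') × position (α y') < position t

  -- An excursion along a lower half-edge y' comes back to the vertex at σ y', right after α y'.
  tour-returns : ∀ {s y t} → position y ≤ position t → SameVertex G s y → ReturnsBefore s y t → SameVertex G s t
  tour-returns {s} {y} {t} = go (position t ∸ position y) ℕₚ.≤-refl
    where
    advance : ∀ {y} → position y < position t → SameVertex G s y → ReturnsBefore s y t →
              ∃ λ y' → position y < position y' × position y' ≤ position t × SameVertex G s y'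
    advance {y} y<t s∼y returns with T y in Ty
    ... | false = σ y , subst (position y <_) (sym σy≡) ℕₚ.≤-refl , subst (_≤ position t) (sym σy≡) y<t ,
                  SameVertex-σ G s∼y
      where
      σy≡ : position (σ y) ≡ suc (position y)
      σy≡ = trans (cong position (sym (motion-external Ty))) (position-motion y (ℕₚ.≤-<-trans y<t (position<n t)))
    ... | true with returns y s∼y ℕₚ.≤-refl y<t Ty
    ...   | y<αy , αy<t = σ y , subst (position y <_) (sym σy≡) (ℕₚ.m<n⇒m<1+n y<αy) ,
                          subst (_≤ position t) (sym σy≡) αy<t , SameVertex-σ G s∼y
      where
      σy≡ : position (σ y) ≡ suc (position (α y))
      σy≡ = trans (cong position (sym (motion-α-internal Ty)))
                  (position-motion (α y) (ℕₚ.≤-<-trans αy<t (position<n t)))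

    go : ∀ fuel {y} → position t ∸ position y ≤ fuel → position y ≤ position t → SameVertex G s y →
         ReturnsBefore s y t → SameVertex G s t
    go fuel {y} gap y≤t s∼y returns with ℕₚ.m≤n⇒m<n∨m≡n y≤t
    ... | inj₂ y≡t = subst (SameVertex G s) (position-injective y≡t) s∼y
    ... | inj₁ y<t with fuel | advance y<t s∼y returns
    ...   | zero      | _ = contradiction gap (ℕₚ.<⇒≱ (ℕₚ.m<n⇒0<n∸m y<t))
    ...   | suc fuel' | y' , y<y' , y'≤t , s∼y' =
      go fuel' (ℕₚ.≤-pred (ℕₚ.<-≤-trans (ℕₚ.∸-monoʳ-< y<y' y'≤t) gap)) y'≤t s∼y'
         λ y'' s∼y'' y'≤y'' → returns y'' s∼y'' (ℕₚ.≤-trans (ℕₚ.<⇒≤ y<y') y'≤y'')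

  -- Cuts of tree edges and edge exchange

  Lower : Fin n → Set
  Lower l = T l ≡ true × position l < position (α l)

  abstract
    lowerHalf : ∀ h → ∃ λ l → SameEdge G h l × position l < position (α l)
    lowerHalf h with ℕₚ.<-cmp (position h) (position (α h))
    ... | tri< h<αh _ _ = h , SameEdge-refl G h , h<αh
    ... | tri≈ _ h≡αh _ = ⊥-elim (position-α≢ h h≡αh)
    ... | tri> _ _ αh<h = α h , SameEdge-α G h , subst (λ z → position (α h) < position z) (sym (α-invol h)) αh<h

  lowerHalf-≤ : ∀ {l b} → position l < position (α l) → SameEdge G l b → position l ≤ position b
  lowerHalf-≤ _    (inj₁ refl) = ℕₚ.≤-refl
  lowerHalf-≤ l<αl (inj₂ refl) = ℕₚ.<⇒≤ l<αl

  -- For a lower half-edge l of a tree edge, the tour from l to α l explores exactly the side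
  -- of α l in T minus l (Inside-Conn).
  Inside : Fin n → Fin n → Bool
  Inside l x = (position l <ᵇ position x) ∧ (position x ≤ᵇ position (α l))

  Inside-true⇒ : ∀ {l x} → Inside l x ≡ true → position l < position x × position x ≤ position (α l)
  Inside-true⇒ {l} {x} eq with Equivalence.to T-∧ (Equivalence.from T-≡ eq)
  ... | l<x , x≤αl = ℕₚ.<ᵇ⇒< _ _ l<x , ℕₚ.≤ᵇ⇒≤ _ _ x≤αl

  Inside-intro : ∀ {l x} → position l < position x → position x ≤ position (α l) → Inside l x ≡ true
  Inside-intro l<x x≤αl = Equivalence.to T-≡ (Equivalence.from T-∧ (ℕₚ.<⇒<ᵇ l<x , ℕₚ.≤⇒≤ᵇ x≤αl))

  Inside-false⇒ : ∀ {l x} → Inside l x ≡ false → position x ≤ position l ⊎ position (α l) < position x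
  Inside-false⇒ {l} {x} eq with position l ℕ.<? position x | position x ℕ.≤? position (α l)
  ... | no ¬l<x | _        = inj₁ (ℕₚ.≮⇒≥ ¬l<x)
  ... | yes _   | no ¬x≤αl = inj₂ (ℕₚ.≰⇒> ¬x≤αl)
  ... | yes l<x | yes x≤αl with () ← trans (sym (Inside-intro l<x x≤αl)) eq

  Inside-≤ : ∀ {l x} → position x ≤ position l → Inside l x ≡ false
  Inside-≤ x≤l = ¬-not λ eq → ℕₚ.<⇒≱ (proj₁ (Inside-true⇒ eq)) x≤l

  Inside-> : ∀ {l x} → position (α l) < position x → Inside l x ≡ false
  Inside-> αl<x = ¬-not λ eq → ℕₚ.<⇒≱ αl<x (proj₂ (Inside-true⇒ eq))

  Inside-self : ∀ {l} → Inside l l ≡ false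
  Inside-self = Inside-≤ ℕₚ.≤-refl

  Inside-α-self : ∀ {l} → position l < position (α l) → Inside l (α l) ≡ true
  Inside-α-self l<αl = Inside-intro l<αl ℕₚ.≤-refl

  Conn-avoiding : ∀ l {a b} → a ≤ b → b ≤ n →
                  (∀ j → a ≤ j → j < b → j ≢ position l × j ≢ position (α l)) →
                  Conn G (TreeWithout l) (orbit a) (orbit b)
  Conn-avoiding l a≤b b≤n avoids = Conn-orbit a≤b λ j a≤j j<b Tj →
    let j≡ = λ {y} (j≡y : orbit j ≡ y) → trans (sym (position-orbit (ℕₚ.<-≤-trans j<b b≤n))) (cong position j≡y)
    in Tj , λ { (inj₁ j≡l)  → proj₁ (avoids j a≤j j<b) (j≡ j≡l)
              ; (inj₂ j≡αl) → proj₂ (avoids j a≤j j<b) (j≡ j≡αl) }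

  Conn-inside : ∀ {l x} → Lower l → Inside l x ≡ true → Conn G (TreeWithout l) x (α l)
  Conn-inside {l} {x} (_ , l<αl) inside with Inside-true⇒ inside
  ... | l<x , x≤αl = subst₂ (Conn G (TreeWithout l)) (orbit-position x) (orbit-position (α l))
    (Conn-avoiding l x≤αl (ℕₚ.<⇒≤ (position<n (α l))) λ j x≤j j<αl →
      (λ j≡l → ℕₚ.<-irrefl (sym j≡l) (ℕₚ.<-≤-trans l<x x≤j)) ,
      (λ j≡αl → ℕₚ.<-irrefl j≡αl j<αl))

  Conn-outside : ∀ {l x} → Lower l → Inside l x ≡ false → Conn G (TreeWithout l) x l
  Conn-outside {l} {x} (_ , l<αl) outside =
    subst₂ (Conn G (TreeWithout l)) (orbit-position x) (orbit-position l) (reach (Inside-false⇒ outside))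
    where
    below-l : ∀ j → j < position l → j ≢ position l × j ≢ position (α l)
    below-l j j<l = (λ j≡l → ℕₚ.<-irrefl j≡l j<l) ,
                    (λ j≡αl → ℕₚ.<-irrefl j≡αl (ℕₚ.<-trans j<l l<αl))
    from-start : Conn G (TreeWithout l) (orbit 0) (orbit (position l))
    from-start = Conn-avoiding l z≤n (ℕₚ.<⇒≤ (position<n l)) λ j _ → below-l j
    reach : position x ≤ position l ⊎ position (α l) < position x →
            Conn G (TreeWithout l) (orbit (position x)) (orbit (position l))
    reach (inj₁ x≤l) = Conn-avoiding l x≤l (ℕₚ.<⇒≤ (position<n l)) λ j _ → below-l j
    reach (inj₂ αl<x) = subst (Conn G (TreeWithout l) _) orbit-n
      (Conn-avoiding l (ℕₚ.<⇒≤ (position<n x)) ℕₚ.≤-refl λ j x≤j _ →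
        (λ j≡l → ℕₚ.<-irrefl (sym j≡l) (ℕₚ.<-trans l<αl (ℕₚ.<-≤-trans αl<x x≤j))) ,
        (λ j≡αl → ℕₚ.<-irrefl (sym j≡αl) (ℕₚ.<-≤-trans αl<x x≤j)))
      ◅◅ from-start

  Inside-Conn : ∀ {l x y} → Lower l → Conn G (TreeWithout l) x y → Inside l x ≡ Inside l y
  Inside-Conn {l} {x} {y} lower x~y with Inside l x in Ix | Inside l y in Iy
  ... | true  | true  = refl
  ... | false | false = refl
  ... | true  | false = ⊥-elim (tree-acyclic (proj₁ lower)
    (Conn-sym G (TreeWithout-α l) (Conn-outside lower Iy) ◅◅
     Conn-sym G (TreeWithout-α l) x~y ◅◅ Conn-inside lower Ix))
  ... | false | true  = ⊥-elim (tree-acyclic (proj₁ lower)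
    (Conn-sym G (TreeWithout-α l) (Conn-outside lower Ix) ◅◅ x~y ◅◅ Conn-inside lower Iy))

  Inside-σ : ∀ {l} → Lower l → ∀ a → Inside l (σ a) ≡ Inside l a
  Inside-σ lower a = sym (Inside-Conn lower (Conn-σ G a))

  Inside-α : ∀ {l a} → Lower l → TreeWithout l a → Inside l (α a) ≡ Inside l a
  Inside-α lower a∈ = sym (Inside-Conn lower (Conn-α G a∈))

  Inside-SameVertex : ∀ {l x y} → Lower l → SameVertex G x y → Inside l x ≡ Inside l y
  Inside-SameVertex lower x∼y = Inside-Conn lower (Conn-SameVertex G x∼y)

  Lower-Crosses : ∀ {l h} → Lower l → SameEdge G l h → Crosses G (Inside l) h
  Lower-Crosses {l} (_ , l<αl) l∼h =
    SameEdge-crosses G {Inside l} l∼h (crosses-by G {Inside l} Inside-self (Inside-α-self l<αl))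

  Crosses-external : ∀ {l x} → Lower l → Crosses G (Inside l) x → ¬ SameEdge G l x → T x ≡ false
  Crosses-external {l} {x} lower crosses ¬l∼x with T x in Tx
  ... | false = refl
  ... | true  = ⊥-elim (crosses (sym (Inside-α lower (Tx , ¬l∼x))))

  Exchange : Fin n → Fin n → Fin n → Set
  Exchange l b y = TreeWithout l y ⊎ SameEdge G b y

  Exchange-α : ∀ {l b y} → Exchange l b y → Exchange l b (α y)
  Exchange-α {l} (inj₁ y∈) = inj₁ (TreeWithout-α l y∈)
  Exchange-α     (inj₂ b∼y) = inj₂ (SameEdge-αʳ G b∼y)

  exchange-connected : ∀ {l b} → Lower l → Crosses G (Inside l) b → ∀ h h' → Conn G (Exchange l b) h h'
  exchange-connected {l} {b} lower b-crosses h h' = to-l h ◅◅ Conn-sym G Exchange-α (to-l h')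
    where
    via-tree : ∀ {x y} → Conn G (TreeWithout l) x y → Conn G (Exchange l b) x y
    via-tree = Conn-mono G inj₁
    to-l : ∀ h → Conn G (Exchange l b) h l
    to-l h with Inside l h in Ih | crossing-half G b-crosses
    ... | false | _ = via-tree (Conn-outside lower Ih)
    ... | true  | b' , b∼b' , Ib' , Iαb' =
      via-tree (Conn-inside lower Ih ◅◅ Conn-sym G (TreeWithout-α l) (Conn-inside lower Ib')) ◅◅
      Conn-α G (inj₂ b∼b') ◅◅ via-tree (Conn-outside lower Iαb')

  -- The edge of h crosses the cut Inside m of its lower half m; if b crosses that cut too, then
  -- b preserves Inside l xor Inside m, which the edge of h still crosses.
  exchange-acyclic-tree : ∀ {l b h m} → Lower l → Crosses G (Inside l) b → TreeWithout l h →
                          SameEdge G h m → position m < position (α m) →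
                          ¬ Conn G (λ x → Exchange l b x × ¬ SameEdge G h x) h (α h)
  exchange-acyclic-tree {l} {b} {h} {m} lower b-crosses (Th , ¬l∼h) h∼m m<αm h~αh
    with Inside m b Boolₚ.≟ Inside m (α b)
  ... | yes b-uncrossed = h-crosses (Conn-invariant G (Inside m) (Inside-σ lower-m) preserved h~αh)
    where
    lower-m = trans (SameEdge-T h∼m) Th , m<αm
    h-crosses = Lower-Crosses lower-m (SameEdge-sym G h∼m)
    preserved : ∀ {a} → Exchange l b a × ¬ SameEdge G h a → Inside m (α a) ≡ Inside m a
    preserved (inj₁ (Ta , _) , ¬h∼a) = Inside-α lower-m (Ta , λ m∼a → ¬h∼a (SameEdge-trans G h∼m m∼a))
    preserved (inj₂ b∼a , _)         = sym (SameEdge-uncrossed G b∼a b-uncrossed)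
  ... | no b-crosses-m = h-crosses (xor-cancelˡ (Inside l h)
      (trans (Conn-invariant G P (λ a → cong₂ _xor_ (Inside-σ lower a) (Inside-σ lower-m a)) preserved h~αh)
             (cong (_xor Inside m (α h)) (Inside-α lower (Th , ¬l∼h)))))
    where
    lower-m = trans (SameEdge-T h∼m) Th , m<αm
    h-crosses = Lower-Crosses lower-m (SameEdge-sym G h∼m)
    P : Fin n → Bool
    P a = Inside l a xor Inside m a
    preserved : ∀ {a} → Exchange l b a × ¬ SameEdge G h a → P (α a) ≡ P a
    preserved (inj₁ (Ta , ¬l∼a) , ¬h∼a) =
      cong₂ _xor_ (Inside-α lower (Ta , ¬l∼a))
                  (Inside-α lower-m (Ta , λ m∼a → ¬h∼a (SameEdge-trans G h∼m m∼a)))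
    preserved (inj₂ b∼a , _) =
      xor-Crosses G {Inside l} {Inside m} (SameEdge-crosses G b∼a b-crosses) (SameEdge-crosses G b∼a b-crosses-m)

  exchange-acyclic : ∀ {l b} → Lower l → Crosses G (Inside l) b →
                     ∀ h → Exchange l b h → ¬ Conn G (λ x → Exchange l b x × ¬ SameEdge G h x) h (α h)
  exchange-acyclic {l} {b} lower b-crosses h (inj₂ b∼h) h~αh =
    SameEdge-crosses G b∼h b-crosses (Conn-invariant G (Inside l) (Inside-σ lower) preserved h~αh)
    where
    preserved : ∀ {a} → Exchange l b a × ¬ SameEdge G h a → Inside l (α a) ≡ Inside l a
    preserved (inj₁ a∈ , _)      = Inside-α lower a∈
    preserved (inj₂ b∼a , ¬h∼a) = ⊥-elim (¬h∼a (SameEdge-trans G (SameEdge-sym G b∼h) b∼a))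
  exchange-acyclic lower b-crosses h (inj₁ h∈) =
    exchange-acyclic-tree lower b-crosses h∈ (proj₁ (proj₂ (lowerHalf h))) (proj₂ (proj₂ (lowerHalf h)))

  exchange : ∀ {l b} → Lower l → Crosses G (Inside l) b → IsSpanningTree G (Exchange l b)
  exchange lower b-crosses = exchange-connected lower b-crosses , exchange-acyclic lower b-crosses

  -- Fundamental cocycles and cycles

  IsTail-lower : ∀ {l} → Lower l → IsTail G ST l
  IsTail-lower (Tl , l<αl) = inj₁ (Tl , position<⇒≺ l<αl)

  IsTail-external : ∀ {h} → T h ≡ false → position (α h) < position h → IsTail G ST h
  IsTail-external Th αh<h = inj₂ ((λ Th' → T-true-false Th' Th) , position<⇒≺ αh<h)

  IsTail-internal⇒ : ∀ {h} → IsTail G ST h → T h ≡ true → position h < position (α h)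
  IsTail-internal⇒ (inj₁ (_ , h≺αh)) _  = ≺⇒position< h≺αh
  IsTail-internal⇒ (inj₂ (¬Th , _))  Th = ⊥-elim (¬Th Th)

  IsTail-external⇒ : ∀ {h} → IsTail G ST h → T h ≡ false → position (α h) < position h
  IsTail-external⇒ (inj₁ (Th , _))  Th' = ⊥-elim (T-true-false Th Th')
  IsTail-external⇒ (inj₂ (_ , αh≺h)) _  = ≺⇒position< αh≺h

  ¬IsTail-upper : ∀ {m} → Lower m → ¬ IsTail G ST (α m)
  ¬IsTail-upper {m} (Tm , m<αm) tail =
    ℕₚ.<-asym m<αm (subst (λ z → position (α m) < position z) (α-invol m) (IsTail-internal⇒ tail (T-α Tm)))

  ≺E-irrefl : ∀ {e e'} → SameEdge G e e' → ¬ _≺E_ G ST e' e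
  ≺E-irrefl e∼e' (a , e'∼a , a≺) = ℕₚ.<-irrefl refl (≺⇒position< (a≺ a (SameEdge-trans G e∼e' e'∼a)))

  ≺E⇒position< : ∀ {e e' l} → _≺E_ G ST e' e → SameEdge G e l →
                 ∃ λ a → SameEdge G e' a × position a < position l
  ≺E⇒position< (a , e'∼a , a≺) e∼l = a , e'∼a , ≺⇒position< (a≺ _ e∼l)

  ≺E-intro : ∀ {e e' a l} → SameEdge G e' a → SameEdge G e l → position l < position (α l) →
             position a < position l → _≺E_ G ST e' e
  ≺E-intro e'∼a e∼l l<αl a<l = _ , e'∼a , λ b e∼b →
    position<⇒≺ (ℕₚ.<-≤-trans a<l (lowerHalf-≤ l<αl (SameEdge-trans G (SameEdge-sym G e∼l) e∼b)))

  module FundamentalCocycle (e : Fin n) (Te : T e ≡ true) where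

    D : Fin n → Set
    D = FundCocycle G ST e

    l : Fin n
    l = proj₁ (lowerHalf e)

    e∼l : SameEdge G e l
    e∼l = proj₁ (proj₂ (lowerHalf e))

    lower : Lower l
    lower = trans (SameEdge-T e∼l) Te , proj₂ (proj₂ (lowerHalf e))

    ¬e∼⇒¬l∼ : ∀ {y} → ¬ SameEdge G e y → ¬ SameEdge G l y
    ¬e∼⇒¬l∼ ¬e∼y l∼y = ¬e∼y (SameEdge-trans G e∼l l∼y)

    crosses⇒FundCocycle : ∀ {x} → Crosses G (Inside l) x → D x
    crosses⇒FundCocycle {x} x-crosses = IsSpanningTree-resp G to from (exchange lower x-crosses)
      where
      to : ∀ {y} → Exchange l x y → (T y ≡ true × ¬ SameEdge G e y) ⊎ SameEdge G x y
      to (inj₁ (Ty , ¬l∼y)) = inj₁ (Ty , λ e∼y → ¬l∼y (SameEdge-trans G (SameEdge-sym G e∼l) e∼y))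
      to (inj₂ x∼y)         = inj₂ x∼y
      from : ∀ {y} → (T y ≡ true × ¬ SameEdge G e y) ⊎ SameEdge G x y → Exchange l x y
      from (inj₁ (Ty , ¬e∼y)) = inj₁ (Ty , ¬e∼⇒¬l∼ ¬e∼y)
      from (inj₂ x∼y)         = inj₂ x∼y

    FundCocycle⇒crosses : ∀ {x} → D x → Crosses G (Inside l) x
    FundCocycle⇒crosses {x} (connected , _) x-uncrossed =
      Lower-Crosses lower (SameEdge-refl G l) (Conn-invariant G (Inside l) (Inside-σ lower) preserved (connected l (α l)))
      where
      preserved : ∀ {a} → (T a ≡ true × ¬ SameEdge G e a) ⊎ SameEdge G x a → Inside l (α a) ≡ Inside l a
      preserved (inj₁ (Ta , ¬e∼a)) = Inside-α lower (Ta , ¬e∼⇒¬l∼ ¬e∼a)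
      preserved (inj₂ x∼a)         = sym (SameEdge-uncrossed G x∼a x-uncrossed)

    ¬FundCocycle-tree : ∀ {y} → TreeWithout l y → ¬ D y
    ¬FundCocycle-tree y∈ Dy = FundCocycle⇒crosses Dy (sym (Inside-α lower y∈))

    Inside-Conn-¬FundCocycle : ∀ {x y} → Conn G (λ z → ¬ D z) x y → Inside l x ≡ Inside l y
    Inside-Conn-¬FundCocycle = Conn-invariant G (Inside l) (Inside-σ lower)
      λ ¬Da → ¬Crosses G {Inside l} λ crosses → ¬Da (crosses⇒FundCocycle crosses)

    directed⇒active : DirectedCocycle G ST D → Active G ST e
    directed⇒active (c , directed) = inj₂ (Te , minimal)
      where
      minimal : MinimalIn G ST e D
      minimal e' De' e'≺e with SameEdge? G e e'
      ... | yes e∼e' = ≺E-irrefl e∼e' e'≺e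
      ... | no ¬e∼e' with ≺E⇒position< e'≺e e∼l
      ...   | a , e'∼a , a<l = proj₂ (directed l (crosses⇒FundCocycle l-crosses) (IsTail-lower lower)) l~c
        where
        l-crosses = Lower-Crosses lower (SameEdge-refl G l)
        αa-crosses = SameEdge-crosses G (SameEdge-αʳ G e'∼a) (FundCocycle⇒crosses De')
        a-outside : Inside l a ≡ false
        a-outside = Inside-≤ (ℕₚ.<⇒≤ a<l)
        αa-inside : Inside l (α a) ≡ true
        αa-inside = crosses-into G {Inside l} (SameEdge-crosses G e'∼a (FundCocycle⇒crosses De')) a-outside
        ¬l∼αa : ¬ SameEdge G l (α a)
        ¬l∼αa l∼αa = ¬e∼e' (SameEdge-trans G (SameEdge-trans G e∼l l∼αa)
                                             (SameEdge-sym G (SameEdge-αʳ G e'∼a)))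
        αa-tail : IsTail G ST (α a)
        αa-tail = IsTail-external (Crosses-external lower αa-crosses ¬l∼αa)
          (subst (λ z → position z < position (α a)) (sym (α-invol a))
                 (ℕₚ.<-trans a<l (proj₁ (Inside-true⇒ αa-inside))))
        l~c : Conn G (λ z → ¬ D z) l c
        l~c = Conn-mono G ¬FundCocycle-tree (Conn-sym G (TreeWithout-α l) (Conn-outside lower a-outside)) ◅◅
              subst (λ z → Conn G (λ z → ¬ D z) z c) (α-invol a)
                    (proj₁ (directed (α a) (crosses⇒FundCocycle αa-crosses) αa-tail))

    active⇒directed : Active G ST e → DirectedCocycle G ST D
    active⇒directed (inj₁ (¬Te , _))     = ⊥-elim (¬Te Te)
    active⇒directed (inj₂ (_ , minimal)) = α l , towards-αl
      where
      towards-αl : ∀ h → D h → IsTail G ST h →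
                   Conn G (λ z → ¬ D z) (α h) (α l) × ¬ Conn G (λ z → ¬ D z) h (α l)
      towards-αl h Dh tail with SameEdge? G l h
      ... | yes (inj₁ refl) = ε , λ l~αl → Lower-Crosses lower (SameEdge-refl G l) (Inside-Conn-¬FundCocycle l~αl)
      ... | yes (inj₂ refl) = ⊥-elim (¬IsTail-upper lower tail)
      ... | no ¬l∼h = Conn-mono G ¬FundCocycle-tree (Conn-inside lower αh-inside) ,
                      λ h~αl → contradiction
                        (trans (sym h-outside) (trans (Inside-Conn-¬FundCocycle h~αl) (Inside-α-self (proj₂ lower))))
                        λ ()
        where
        h-crosses = FundCocycle⇒crosses Dh
        Th = Crosses-external lower h-crosses ¬l∼h
        αh<h = IsTail-external⇒ tail Th
        l≤αh : position l ≤ position (α h)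
        l≤αh = ℕₚ.≮⇒≥ λ αh<l → minimal h Dh (≺E-intro (SameEdge-α G h) e∼l (proj₂ lower) αh<l)
        l<αh : position l < position (α h)
        l<αh = ℕₚ.≤∧≢⇒< l≤αh λ l≡αh → ¬l∼h (SameEdge-α⁻ʳ G (inj₁ (sym (position-injective l≡αh))))
        h-outside : Inside l h ≡ false
        h-outside = ¬-not λ Ih → h-crosses (trans Ih (sym (Inside-intro l<αh
          (ℕₚ.≤-trans (ℕₚ.<⇒≤ αh<h) (proj₂ (Inside-true⇒ Ih))))))
        αh-inside : Inside l (α h) ≡ true
        αh-inside = crosses-into G {Inside l} h-crosses h-outside

    directed⇔active : DirectedCocycle G ST D ⇔ Active G ST e
    directed⇔active = mk⇔ directed⇒active active⇒directed

  module FundamentalCycle (e : Fin n) (Te : T e ≡ false) where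

    C : Fin n → Set
    C = FundCycle G ST e

    e₁ e₂ : Fin n
    e₁ = proj₁ (lowerHalf e)
    e₂ = α e₁

    e∼e₁ : SameEdge G e e₁
    e∼e₁ = proj₁ (proj₂ (lowerHalf e))

    e∼e₂ : SameEdge G e e₂
    e∼e₂ = SameEdge-αʳ G e∼e₁

    e₁<e₂ : position e₁ < position e₂
    e₁<e₂ = proj₂ (proj₂ (lowerHalf e))

    Te₁ : T e₁ ≡ false
    Te₁ = trans (SameEdge-T e∼e₁) Te

    Te₂ : T e₂ ≡ false
    Te₂ = T-α Te₁

    e₂-tail : IsTail G ST e₂
    e₂-tail = IsTail-external Te₂ (subst (λ z → position z < position e₂) (sym (α-invol e₁)) e₁<e₂)

    ¬e₁-tail : ¬ IsTail G ST e₁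
    ¬e₁-tail tail = ℕₚ.<-asym e₁<e₂ (IsTail-external⇒ tail Te₁)

    FundCycle-self : ∀ {x} → SameEdge G e x → C x
    FundCycle-self {x} e∼x = IsSpanningTree-resp G to from T-tree
      where
      to : ∀ {y} → T y ≡ true → (T y ≡ true ⊎ SameEdge G e y) × ¬ SameEdge G x y
      to Ty = inj₁ Ty , λ x∼y → internal-external-¬SameEdge Ty (trans (SameEdge-T e∼x) Te) (SameEdge-sym G x∼y)
      from : ∀ {y} → (T y ≡ true ⊎ SameEdge G e y) × ¬ SameEdge G x y → T y ≡ true
      from (inj₁ Ty  , _)    = Ty
      from (inj₂ e∼y , ¬x∼y) = ⊥-elim (¬x∼y (SameEdge-trans G (SameEdge-sym G e∼x) e∼y))

    crosses⇒FundCycle : ∀ {x m} → SameEdge G x m → Lower m → Crosses G (Inside m) e → C x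
    crosses⇒FundCycle {x} {m} x∼m lower-m e-crosses = IsSpanningTree-resp G to from (exchange lower-m e-crosses)
      where
      to : ∀ {y} → Exchange m e y → (T y ≡ true ⊎ SameEdge G e y) × ¬ SameEdge G x y
      to (inj₁ (Ty , ¬m∼y)) = inj₁ Ty , λ x∼y → ¬m∼y (SameEdge-trans G (SameEdge-sym G x∼m) x∼y)
      to (inj₂ e∼y)         = inj₂ e∼y , λ x∼y →
        internal-external-¬SameEdge (proj₁ lower-m) (trans (SameEdge-T e∼y) Te)
                                    (SameEdge-trans G (SameEdge-sym G x∼m) x∼y)
      from : ∀ {y} → (T y ≡ true ⊎ SameEdge G e y) × ¬ SameEdge G x y → Exchange m e y
      from (inj₁ Ty  , ¬x∼y) = inj₁ (Ty , λ m∼y → ¬x∼y (SameEdge-trans G x∼m m∼y))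
      from (inj₂ e∼y , _)    = inj₂ e∼y

    FundCycle⇒ : ∀ {x} → C x → SameEdge G e x ⊎ ∃ λ m → SameEdge G x m × Lower m × Crosses G (Inside m) e
    FundCycle⇒ {x} (connected , acyclic) with SameEdge? G e x | T x in Tx
    ... | yes e∼x | _     = inj₁ e∼x
    ... | no ¬e∼x | false = ⊥-elim (acyclic e (inj₂ (SameEdge-refl G e) , λ x∼e → ¬e∼x (SameEdge-sym G x∼e))
                                      (Conn-mono G tree⊆ (proj₁ T-tree e (α e))))
      where
      tree⊆ : ∀ {y} → T y ≡ true → ((T y ≡ true ⊎ SameEdge G e y) × ¬ SameEdge G x y) × ¬ SameEdge G e y
      tree⊆ Ty = (inj₁ Ty , λ x∼y → internal-external-¬SameEdge Ty Tx (SameEdge-sym G x∼y)) ,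
                 λ e∼y → internal-external-¬SameEdge Ty Te (SameEdge-sym G e∼y)
    ... | no ¬e∼x | true with lowerHalf x
    ...   | m , x∼m , m<αm = inj₂ (m , x∼m , lower-m , e-crosses)
      where
      lower-m = trans (SameEdge-T x∼m) Tx , m<αm
      e-crosses : Crosses G (Inside m) e
      e-crosses e-uncrossed = Lower-Crosses lower-m (SameEdge-refl G m)
        (Conn-invariant G (Inside m) (Inside-σ lower-m) preserved (connected m (α m)))
        where
        preserved : ∀ {a} → (T a ≡ true ⊎ SameEdge G e a) × ¬ SameEdge G x a → Inside m (α a) ≡ Inside m a
        preserved (inj₁ Ta , ¬x∼a) = Inside-α lower-m (Ta , λ m∼a → ¬x∼a (SameEdge-trans G x∼m m∼a))
        preserved (inj₂ e∼a , _)   = sym (SameEdge-uncrossed G e∼a e-uncrossed)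

    crosses-before : ∀ {m} → Crosses G (Inside m) e → position m < position e₁ → Inside m e₂ ≡ false
    crosses-before {m} e-crosses m<e₁ = ¬-not λ e₂-inside →
      SameEdge-crosses G {Inside m} e∼e₁ e-crosses
        (trans (Inside-intro m<e₁ (ℕₚ.<⇒≤ (ℕₚ.<-≤-trans e₁<e₂ (proj₂ (Inside-true⇒ e₂-inside))))) (sym e₂-inside))

    crosses-after : ∀ {m} → Lower m → Crosses G (Inside m) e → position e₁ < position m →
                    position m < position e₂ × position e₂ < position (α m)
    crosses-after {m} lower-m e-crosses e₁<m =
      proj₁ (Inside-true⇒ e₂-inside) ,
      ℕₚ.≤∧≢⇒< (proj₂ (Inside-true⇒ e₂-inside))
        λ e₂≡αm → internal-external-¬SameEdge (T-α (proj₁ lower-m)) Te₂ (inj₁ (position-injective e₂≡αm))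
      where
      e₂-inside : Inside m e₂ ≡ true
      e₂-inside = crosses-into G {Inside m} (SameEdge-crosses G {Inside m} e∼e₁ e-crosses) (Inside-≤ (ℕₚ.<⇒≤ e₁<m))

    -- In C only m and e cross the cut of m, and both are oriented into Inside m (m → α m and e₂ → e₁),
    -- so a directed cycle through m could never get back out to m.
    ¬directed-cut : DirectedCycle G ST C → ∀ {m} → Lower m → Crosses G (Inside m) e → Inside m e₂ ≡ false → ⊥
    ¬directed-cut (k , f , _ , tail-in , covers , consecutive) {m} lower-m e-crosses e₂-outside =
      contradiction (trans (sym (Inside-self {m}))
                           (subst (λ z → Inside m z ≡ true) fi₀≡m (next-closed Inside-f step start)))
                    λ ()
      where
      Inside-f : Fin (suc k) → Set
      Inside-f i = Inside m (f i) ≡ true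
      m-covered = covers m (crosses⇒FundCycle (SameEdge-refl G m) lower-m e-crosses)
      i₀ = proj₁ m-covered
      fi₀≡m : f i₀ ≡ m
      fi₀≡m = [ id , (λ fi₀≡αm → ⊥-elim (¬IsTail-upper lower-m (subst (IsTail G ST) fi₀≡αm (proj₁ (tail-in i₀))))) ]′
              (proj₂ m-covered)
      internal-tail : ∀ i → Inside-f i → T (f i) ≡ true
      internal-tail i inside =
        [ on-e , (λ (_ , fi∼m' , lower-m' , _) → trans (sym (SameEdge-T fi∼m')) (proj₁ lower-m')) ]′
        (FundCycle⇒ (proj₂ (tail-in i)))
        where
        on-e : SameEdge G e (f i) → T (f i) ≡ true
        on-e e∼fi with SameEdge-trans G (SameEdge-sym G e∼e₁) e∼fi
        ... | inj₁ fi≡e₁ = ⊥-elim (¬e₁-tail (subst (IsTail G ST) fi≡e₁ (proj₁ (tail-in i))))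
        ... | inj₂ fi≡e₂ with () ← trans (sym inside) (trans (cong (Inside m) fi≡e₂) e₂-outside)
      tree-tail : ∀ i → Inside-f i → TreeWithout m (f i)
      tree-tail i inside = internal-tail i inside , λ
        { (inj₁ fi≡m)  → contradiction (trans (sym inside) (trans (cong (Inside m) fi≡m) Inside-self)) λ ()
        ; (inj₂ fi≡αm) → ¬IsTail-upper lower-m (subst (IsTail G ST) fi≡αm (proj₁ (tail-in i))) }
      step : ∀ i → Inside-f i → Inside-f (next i)
      step i inside = trans (sym (Inside-SameVertex lower-m (consecutive i)))
                            (trans (Inside-α lower-m (tree-tail i inside)) inside)
      start : Inside-f (next i₀)
      start = trans (sym (Inside-SameVertex lower-m (consecutive i₀)))
                    (trans (cong (λ z → Inside m (α z)) fi₀≡m) (Inside-α-self (proj₂ lower-m)))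

    directed⇒active : DirectedCycle G ST C → Active G ST e
    directed⇒active directed = inj₁ ((λ Te' → T-true-false Te' Te) , minimal)
      where
      minimal : MinimalIn G ST e C
      minimal e' Ce' e'≺e with FundCycle⇒ Ce'
      ... | inj₁ e∼e' = ≺E-irrefl e∼e' e'≺e
      ... | inj₂ (m , e'∼m , lower-m , e-crosses) with ≺E⇒position< e'≺e e∼e₁
      ...   | a , e'∼a , a<e₁ = ¬directed-cut directed lower-m e-crosses (crosses-before e-crosses
              (ℕₚ.≤-<-trans (lowerHalf-≤ (proj₂ lower-m) (SameEdge-trans G (SameEdge-sym G e'∼m) e'∼a)) a<e₁))

    module Construction (minimal : MinimalIn G ST e C) where

      -- The arcs of the directed cycle: the half-edges at straddling positions between e₁ and e₂,
      -- in tour order, followed by e₂.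
      Straddles : ℕ → Set
      Straddles r = T (orbit r) ≡ true × position e₂ < position (α (orbit r))

      straddles-at : ∀ {y} → T y ≡ true → position e₂ < position (α y) → Straddles (position y)
      straddles-at {y} Ty e₂<αy =
        subst (λ z → T z ≡ true × position e₂ < position (α z)) (sym (orbit-position y)) (Ty , e₂<αy)

      straddles? : ∀ r → Dec (Straddles r)
      straddles? r = (T (orbit r) Boolₚ.≟ true) ×-dec (position e₂ ℕ.<? position (α (orbit r)))

      open Enumeration (enumerate straddles? e₁<e₂)

      position-point : ∀ {j} → j ≤ suc size → position (orbit (point j)) ≡ point j
      position-point j≤ = position-orbit (ℕₚ.≤-<-trans (point≤last j≤) (position<n e₂))

      straddling : ∀ {j} → j < size → Lower (orbit (point (suc j))) × C (orbit (point (suc j)))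
      straddling {j} j<size = lower-x , crosses⇒FundCycle (SameEdge-refl G x) lower-x e-crosses
        where
        x = orbit (point (suc j))
        x≡ : position x ≡ point (suc j)
        x≡ = position-point (s≤s (ℕₚ.<⇒≤ j<size))
        x<e₂ : position x < position e₂
        x<e₂ = subst₂ _<_ (sym x≡) point-last (point-mono (s≤s j<size) ℕₚ.≤-refl)
        e₂<αx = proj₂ (point-Q j j<size)
        lower-x : Lower x
        lower-x = proj₁ (point-Q j j<size) , ℕₚ.<-trans x<e₂ e₂<αx
        e₁<x : position e₁ < position x
        e₁<x = subst (position e₁ <_) (sym x≡) (first<point (s≤s z≤n) (s≤s (ℕₚ.<⇒≤ j<size)))
        e-crosses : Crosses G (Inside x) e
        e-crosses = SameEdge-crosses G {Inside x} (SameEdge-sym G e∼e₁)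
          (crosses-by G {Inside x} (Inside-≤ (ℕₚ.<⇒≤ e₁<x)) (Inside-intro x<e₂ (ℕₚ.<⇒≤ e₂<αx)))

      arc : Fin (suc size) → Fin n
      arc i = orbit (point (suc (toℕ i)))

      toℕ≤size : ∀ (i : Fin (suc size)) → toℕ i ≤ size
      toℕ≤size i = ℕₚ.≤-pred (Finₚ.toℕ<n i)

      arc-last : ∀ {i} → toℕ i ≡ size → arc i ≡ e₂
      arc-last i≡size =
        trans (cong (λ j → orbit (point (suc j))) i≡size) (trans (cong orbit point-last) (orbit-position e₂))

      arc-tail-in : ∀ i → IsTail G ST (arc i) × C (arc i)
      arc-tail-in i =
        [ (λ i<size → IsTail-lower (proj₁ (straddling i<size)) , proj₂ (straddling i<size))
        , (λ i≡size → subst (λ z → IsTail G ST z × C z) (sym (arc-last i≡size)) (e₂-tail , FundCycle-self e∼e₂)) ]′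
        (ℕₚ.m≤n⇒m<n∨m≡n (toℕ≤size i))

      arc-injective : Injective _≡_ _≡_ arc
      arc-injective {i} {j} eq = Finₚ.toℕ-injective (ℕₚ.suc-injective
        (point-injective (s≤s (toℕ≤size i)) (s≤s (toℕ≤size j))
          (trans (sym (position-point (s≤s (toℕ≤size i))))
                 (trans (cong position eq) (position-point (s≤s (toℕ≤size j)))))))

      arc-onto : ∀ {y} → T y ≡ true → position e₁ < position y → position y < position e₂ →
                 position e₂ < position (α y) → ∃ λ i → arc i ≡ y
      arc-onto {y} Ty e₁<y y<e₂ e₂<αy = fromℕ< (s≤s j≤size) ,
        trans (cong (λ i → orbit (point (suc i))) (Finₚ.toℕ-fromℕ< (s≤s j≤size)))
              (trans (cong orbit point≡y) (orbit-position y))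
        where
        onto = point-onto e₁<y y<e₂ (straddles-at Ty e₂<αy)
        j≤size = proj₁ (proj₂ onto)
        point≡y = proj₂ (proj₂ onto)

      arc-covers : ∀ e' → C e' → ∃ λ i → SameEdge G e' (arc i)
      arc-covers e' Ce' = [ via-e , via-crossing ]′ (FundCycle⇒ Ce')
        where
        via-e : SameEdge G e e' → ∃ λ i → SameEdge G e' (arc i)
        via-e e∼e' = Fin.fromℕ size ,
          subst (SameEdge G e') (sym (arc-last (Finₚ.toℕ-fromℕ size))) (SameEdge-trans G (SameEdge-sym G e∼e') e∼e₂)
        via-crossing : (∃ λ m → SameEdge G e' m × Lower m × Crosses G (Inside m) e) →
                       ∃ λ i → SameEdge G e' (arc i)
        via-crossing (m , e'∼m , lower-m , e-crosses) = proj₁ onto , subst (SameEdge G e') (sym (proj₂ onto)) e'∼m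
          where
          e₁<m : position e₁ < position m
          e₁<m = ℕₚ.≤∧≢⇒< (ℕₚ.≮⇒≥ λ m<e₁ → minimal e' Ce' (≺E-intro e'∼m e∼e₁ e₁<e₂ m<e₁))
            λ e₁≡m → internal-external-¬SameEdge (proj₁ lower-m) Te₁ (inj₁ (position-injective e₁≡m))
          onto = arc-onto (proj₁ lower-m) e₁<m (proj₁ (crosses-after lower-m e-crosses e₁<m))
                          (proj₂ (crosses-after lower-m e-crosses e₁<m))

      -- departure (suc j) is the head of the j-th arc, and departure 0 = e₁ the head of the last arc e₂.
      departure : ℕ → Fin n
      departure zero    = e₁
      departure (suc j) = α (orbit (point (suc j)))

      motion-departure : ∀ {j} → j ≤ size → motion G ST (orbit (point j)) ≡ σ (departure j)
      motion-departure {zero}  _      = trans (cong (motion G ST) (trans (cong orbit point-zero) (orbit-position e₁)))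
                                              (motion-external Te₁)
      motion-departure {suc j} j<size = motion-internal (proj₁ (point-Q j j<size))

      partner-past : ∀ {j y} → j ≤ size → Lower y → position y < point (suc j) → point (suc j) ≤ position (α y) →
                     position e₂ < position (α y)
      partner-past {j} {y} j≤size (Ty , y<αy) y<j+1 j+1≤αy = [ below-last , at-last ]′ (ℕₚ.m≤n⇒m<n∨m≡n j≤size)
        where
        at-last : j ≡ size → position e₂ < position (α y)
        at-last j≡size =
          ℕₚ.≤∧≢⇒< (subst (_≤ position (α y)) (trans (cong (λ k → point (suc k)) j≡size) point-last) j+1≤αy)
          λ e₂≡αy → internal-external-¬SameEdge (T-α Ty) Te₂ (inj₁ (position-injective e₂≡αy))
        below-last : j < size → position e₂ < position (α y)
        below-last j<size = ℕₚ.<-≤-trans e₂<αx (proj₂ (Inside-true⇒ αx-inside))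
          where
          x = orbit (point (suc j))
          e₂<αx = proj₂ (point-Q j j<size)
          x≡ : position x ≡ point (suc j)
          x≡ = position-point (s≤s (ℕₚ.<⇒≤ j<size))
          y<x = subst (position y <_) (sym x≡) y<j+1
          ¬y∼x : ¬ SameEdge G y x
          ¬y∼x (inj₁ x≡y)  = ℕₚ.<-irrefl (cong position (sym x≡y)) y<x
          ¬y∼x (inj₂ x≡αy) = ℕₚ.<-asym e₂<αx
            (subst (λ z → position z < position e₂) (sym (trans (cong α x≡αy) (α-invol y)))
                   (ℕₚ.<-≤-trans y<j+1 (point≤last (s≤s (ℕₚ.<⇒≤ j<size)))))
          αx-inside : Inside y (α x) ≡ true
          αx-inside = trans (Inside-α (Ty , y<αy) (proj₁ (point-Q j j<size) , ¬y∼x))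
                            (Inside-intro y<x (subst (_≤ position (α y)) (sym x≡) j+1≤αy))

      partner-before : ∀ {j y} → j ≤ size → Lower y → point j < position y → position y < point (suc j) →
                       position (α y) < point (suc j)
      partner-before {j} {y} j≤size lower-y j<y y<j+1 = ℕₚ.≰⇒> λ j+1≤αy →
        point-gap j j≤size (position y) j<y y<j+1
          (straddles-at (proj₁ lower-y) (partner-past j≤size lower-y y<j+1 j+1≤αy))

      ¬upper-at-departure : ∀ {j l} → j ≤ size → Lower l → Inside l (departure j) ≡ true →
                            position (α l) < point (suc j) → ⊥
      ¬upper-at-departure {zero} {l} _ lower-l e₁-inside αl<1 =
        minimal l (crosses⇒FundCycle (SameEdge-refl G l) lower-l e-crosses)
                  (≺E-intro (SameEdge-refl G l) e∼e₁ e₁<e₂ (proj₁ (Inside-true⇒ e₁-inside)))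
        where
        e₂-outside : Inside l e₂ ≡ false
        e₂-outside = Inside-> (ℕₚ.<-≤-trans αl<1 (point≤last (s≤s z≤n)))
        e-crosses : Crosses G (Inside l) e
        e-crosses = SameEdge-crosses G {Inside l} (SameEdge-sym G e∼e₁) λ e₁≡e₂ →
          contradiction (trans (sym e₁-inside) (trans e₁≡e₂ e₂-outside)) λ ()
      ¬upper-at-departure {suc j} {l} j<size _ αx-inside αl<j+2 = ℕₚ.<-irrefl refl (begin-strict
        position e₂          <⟨ proj₂ (point-Q j j<size) ⟩
        position (α x)       ≤⟨ proj₂ (Inside-true⇒ αx-inside) ⟩
        position (α l)       <⟨ αl<j+2 ⟩
        point (suc (suc j))  ≤⟨ point≤last (s≤s j<size) ⟩
        position e₂          ∎)
        where
        open ℕₚ.≤-Reasoning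
        x = orbit (point (suc j))

      lower-at-departure : ∀ {j y} → j ≤ size → SameVertex G (departure j) y → position y < point (suc j) →
                           T y ≡ true → position y < position (α y)
      lower-at-departure {j} {y} j≤size d∼y y<j+1 Ty with ℕₚ.<-cmp (position y) (position (α y))
      ... | tri< y<αy _ _ = y<αy
      ... | tri≈ _ y≡αy _ = ⊥-elim (position-α≢ y y≡αy)
      ... | tri> _ _ αy<y = ⊥-elim (¬upper-at-departure j≤size lower-αy
              (trans (Inside-SameVertex lower-αy d∼y) y-inside) (subst (_< point (suc j)) (sym ααy≡y) y<j+1))
        where
        ααy≡y : position (α (α y)) ≡ position y
        ααy≡y = cong position (α-invol y)
        lower-αy : Lower (α y)
        lower-αy = T-α Ty , subst (position (α y) <_) (sym ααy≡y) αy<y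
        y-inside : Inside (α y) y ≡ true
        y-inside = Inside-intro αy<y (ℕₚ.≤-reflexive (sym ααy≡y))

      departure-arrives : ∀ {j} → j ≤ size → SameVertex G (departure j) (orbit (point (suc j)))
      departure-arrives {j} j≤size = tour-returns start≤t (1 , refl) returns
        where
        t≡ : position (orbit (point (suc j))) ≡ point (suc j)
        t≡ = position-point (s≤s j≤size)
        j≡ : position (orbit (point j)) ≡ point j
        j≡ = position-point (ℕₚ.m≤n⇒m≤1+n j≤size)
        start≡ : position (σ (departure j)) ≡ suc (point j)
        start≡ = trans (cong position (sym (motion-departure j≤size)))
          (trans (position-motion (orbit (point j)) (subst (λ z → suc z < n) (sym j≡)
                   (ℕₚ.≤-<-trans (point-step j j≤size) (subst (_< n) t≡ (position<n _)))))
                 (cong suc j≡))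
        start≤t : position (σ (departure j)) ≤ position (orbit (point (suc j)))
        start≤t = subst₂ _≤_ (sym start≡) (sym t≡) (point-step j j≤size)
        returns : ReturnsBefore (departure j) (σ (departure j)) (orbit (point (suc j)))
        returns y d∼y start≤y y<t Ty =
          y<αy , subst (position (α y) <_) (sym t≡) (partner-before j≤size (Ty , y<αy) j<y y<j+1)
          where
          y<j+1 = subst (position y <_) t≡ y<t
          y<αy = lower-at-departure j≤size d∼y y<j+1 Ty
          j<y = subst (_≤ position y) start≡ start≤y

      arc-consecutive : ∀ i → SameVertex G (α (arc i)) (arc (next i))
      arc-consecutive i = [ wraps , steps ]′ (next-cases i)
        where
        wraps : toℕ i ≡ size × next i ≡ zero → SameVertex G (α (arc i)) (arc (next i))
        wraps (i≡size , next≡zero) = subst₂ (SameVertex G) (sym (trans (cong α (arc-last i≡size)) (α-invol e₁)))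
                                            (cong arc (sym next≡zero)) (departure-arrives z≤n)
        steps : toℕ (next i) ≡ suc (toℕ i) → SameVertex G (α (arc i)) (arc (next i))
        steps next≡ = subst (SameVertex G (α (arc i))) (cong (λ j → orbit (point (suc j))) (sym next≡))
                            (departure-arrives (subst (_≤ size) next≡ (toℕ≤size (next i))))

      directed : DirectedCycle G ST C
      directed = size , arc , arc-injective , arc-tail-in , arc-covers , arc-consecutive

    active⇒directed : Active G ST e → DirectedCycle G ST C
    active⇒directed (inj₁ (_ , minimal)) = Construction.directed minimal
    active⇒directed (inj₂ (Te' , _))     = ⊥-elim (T-true-false Te' Te)

    directed⇔active : DirectedCycle G ST C ⇔ Active G ST e
    directed⇔active = mk⇔ directed⇒active active⇒directed

lemma10 : (G : RootedMap) (ST : SpanningTree G) (e : Fin (RootedMap.n G)) →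
    ((SpanningTree.T ST e ≡ false) → (DirectedCycle G ST (FundCycle G ST e) ⇔ Active G ST e)) ×
    ((SpanningTree.T ST e ≡ true) → (DirectedCocycle G ST (FundCocycle G ST e) ⇔ Active G ST e))
lemma10 G ST e = FundamentalCycle.directed⇔active G ST e , FundamentalCocycle.directed⇔active G ST e
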